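{- If $G$ is a connected graph of order $n \ge 2$, then $\alpha_1(G) \ge 2$, with equality if and only if $G$ is a good graph, i.e. for every edge $uv \in E(G)$ we have $N_G[u] \cup N_G[v] = V(G)$.
   Context: All graphs are finite, simple and undirected. $N_G[v] = \{v\} \cup \{u \in V(G) : uv \in E(G)\}$ is the closed neighbourhood of $v$. An edge $uv$ of $G$ is a good edge if $N_G[u] \cup N_G[v] = V(G)$; $G$ is a good graph if every edge of $G$ is a good edge. For $S \subseteq V(G)$, $\langle S\rangle_G$ denotes the induced subgraph. A $1$-nearly vertex independent set of $G$ is a set $S \subseteq V(G)$ such that $\langle S\rangle_G$ has exactly one edge, and $\alpha_1(G)$ is the maximum cardinality of such a set. -}

module Defs where

open import Data.Nat using (ℕ; _≤_)
open import Data.Fin using (Fin)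
open import Data.Fin.Subset using (Subset; _∈_; ∣_∣)
open import Data.Product using (Σ; _×_; ∃; _,_)
open import Data.Sum using (_⊎_)
open import Relation.Binary.PropositionalEquality using (_≡_)
open import Relation.Nullary using (¬_; Dec)

record Graph (n : ℕ) : Set₁ where
  field
    Adj     : Fin n → Fin n → Set
    adj?    : ∀ u v → Dec (Adj u v)
    sym     : ∀ {u v} → Adj u v → Adj v u
    irrefl  : ∀ {u} → ¬ Adj u u

open Graph public

data Reachable {n : ℕ} (G : Graph n) : Fin n → Fin n → Set where
  here : ∀ {u} → Reachable G u u
  step : ∀ {u v w} → Adj G u v → Reachable G v w → Reachable G u w

Connected : ∀ {n} → Graph n → Set
Connected G = ∀ u v → Reachable G u v

InClosedNbhd : ∀ {n} → Graph n → Fin n → Fin n → Set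
InClosedNbhd G v w = w ≡ v ⊎ Adj G v w

GoodEdge : ∀ {n} → Graph n → Fin n → Fin n → Set
GoodEdge G u v = ∀ w → InClosedNbhd G u w ⊎ InClosedNbhd G v w

GoodGraph : ∀ {n} → Graph n → Set
GoodGraph G = ∀ u v → Adj G u v → GoodEdge G u v

OneNearlyIndependent : ∀ {n} → Graph n → Subset n → Set
OneNearlyIndependent G S =
  Σ (Fin _) λ u → Σ (Fin _) λ v →
    u ∈ S × v ∈ S × Adj G u v ×
    (∀ x y → x ∈ S → y ∈ S → Adj G x y →
       (x ≡ u × y ≡ v) ⊎ (x ≡ v × y ≡ u))

IsAlpha1 : ∀ {n} → Graph n → ℕ → Set
IsAlpha1 G k =
  (∃ λ S → OneNearlyIndependent G S × ∣ S ∣ ≡ k) ×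
  (∀ S → OneNearlyIndependent G S → ∣ S ∣ ≤ k)

{-# OPTIONS --safe #-}
module Submission where

-- An edge uv is a 1-nearly independent set of size 2, and connectivity with n ≥ 2
-- provides one, so α₁(G) ≥ 2. If uv is not good, a vertex w outside N[u] ∪ N[v] is
-- isolated from {u, v}, and {u, v, w} is 1-nearly independent of size 3. Conversely,
-- if the edge uv of a 1-nearly independent set S is good, every other vertex of S would
-- be adjacent to u or v and give S a second edge, so S = {u, v}.

open import Defs
open import Data.Nat using (ℕ; zero; suc; _+_; _≤_; _<_; z≤n; s≤s)
open import Data.Nat.Properties
  using (≤-trans; ≤-antisym; ≤-reflexive; ≤∧≢⇒<; m<1+n⇒m≤n; n≤1+n; +-suc; +-monoʳ-≤)
import Data.Nat.Properties as ℕ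
open import Data.Fin using (Fin; _≟_)
import Data.Fin as Fin
open import Data.Fin.Subset using (Subset; _∈_; _∉_; _⊆_; ∣_∣; ⁅_⁆; _∪_; inside; outside)
open import Data.Fin.Subset.Properties
  using (_∈?_; anySubset?; ∣p∣≤n; ∣⁅x⁆∣≡1; x∈⁅x⁆; x∈⁅y⁆⇒x≡y; x∈p∪q⁺; x∈p∪q⁻; p⊆q⇒∣p∣≤∣q∣; p⊂q⇒∣p∣<∣q∣)
open import Data.Fin.Properties using (any?; all?)
open import Data.Product using (Σ; ∃; ∃₂; _×_; _,_)
open import Data.Sum using (_⊎_; inj₁; inj₂)
open import Data.Vec using ([]; _∷_)
open import Function.Base using (_∘_)
open import Function.Bundles using (_⇔_; mk⇔)
open import Relation.Binary.PropositionalEquality using (_≡_; _≢_; refl; cong₂) renaming (sym to ≡-sym)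
open import Relation.Nullary using (¬_; Dec; yes; no; contradiction)
open import Relation.Nullary.Decidable using (_×-dec_; _⊎-dec_; _→-dec_)
open import Relation.Unary using (Pred; Decidable)

module _ {p} {P : Pred ℕ p} (P? : Decidable P) where

  greatest-bounded : ∀ m {j} → P j → (∀ {i} → P i → i ≤ m) →
                     ∃ λ k → P k × (∀ {i} → P i → i ≤ k)
  greatest-bounded m pj bound with P? m
  ... | yes pm = m , pm , bound
  greatest-bounded zero pj bound | no ¬p0 with bound pj
  ... | z≤n = contradiction pj ¬p0
  greatest-bounded (suc m) pj bound | no ¬pm =
    greatest-bounded m pj λ pi → m<1+n⇒m≤n (≤∧≢⇒< (bound pi) λ { refl → ¬pm pi })

∣p∪q∣≤∣p∣+∣q∣ : ∀ {n} (p q : Subset n) → ∣ p ∪ q ∣ ≤ ∣ p ∣ + ∣ q ∣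
∣p∪q∣≤∣p∣+∣q∣ []            []            = z≤n
∣p∪q∣≤∣p∣+∣q∣ (inside  ∷ p) (inside  ∷ q) =
  s≤s (≤-trans (∣p∪q∣≤∣p∣+∣q∣ p q) (+-monoʳ-≤ ∣ p ∣ (n≤1+n ∣ q ∣)))
∣p∪q∣≤∣p∣+∣q∣ (inside  ∷ p) (outside ∷ q) = s≤s (∣p∪q∣≤∣p∣+∣q∣ p q)
∣p∪q∣≤∣p∣+∣q∣ (outside ∷ p) (inside  ∷ q) =
  ≤-trans (s≤s (∣p∪q∣≤∣p∣+∣q∣ p q)) (≤-reflexive (≡-sym (+-suc ∣ p ∣ ∣ q ∣)))
∣p∪q∣≤∣p∣+∣q∣ (outside ∷ p) (outside ∷ q) = ∣p∪q∣≤∣p∣+∣q∣ p q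

module _ {n : ℕ} where

  ∣p∣<∣⁅x⁆∪p∣ : ∀ {x} {p : Subset n} → x ∉ p → ∣ p ∣ < ∣ ⁅ x ⁆ ∪ p ∣
  ∣p∣<∣⁅x⁆∪p∣ {x} {p} x∉p =
    p⊂q⇒∣p∣<∣q∣ ((λ y∈p → x∈p∪q⁺ (inj₂ y∈p)) , x , x∈p∪q⁺ (inj₁ (x∈⁅x⁆ x)) , x∉p)

  x∈⁅y⁆∪⁅z⁆⁻ : ∀ {x y z : Fin n} → x ∈ ⁅ y ⁆ ∪ ⁅ z ⁆ → x ≡ y ⊎ x ≡ z
  x∈⁅y⁆∪⁅z⁆⁻ {y = y} {z} x∈ with x∈p∪q⁻ ⁅ y ⁆ ⁅ z ⁆ x∈
  ... | inj₁ x∈⁅y⁆ = inj₁ (x∈⁅y⁆⇒x≡y y x∈⁅y⁆)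
  ... | inj₂ x∈⁅z⁆ = inj₂ (x∈⁅y⁆⇒x≡y z x∈⁅z⁆)

  x∈⁅x⁆∪⁅y⁆ : ∀ (x y : Fin n) → x ∈ ⁅ x ⁆ ∪ ⁅ y ⁆
  x∈⁅x⁆∪⁅y⁆ x y = x∈p∪q⁺ (inj₁ (x∈⁅x⁆ x))

  y∈⁅x⁆∪⁅y⁆ : ∀ (x y : Fin n) → y ∈ ⁅ x ⁆ ∪ ⁅ y ⁆
  y∈⁅x⁆∪⁅y⁆ x y = x∈p∪q⁺ {p = ⁅ x ⁆} (inj₂ (x∈⁅x⁆ y))

  ∣⁅x⁆∪⁅y⁆∣≡2 : ∀ {x y : Fin n} → x ≢ y → ∣ ⁅ x ⁆ ∪ ⁅ y ⁆ ∣ ≡ 2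
  ∣⁅x⁆∪⁅y⁆∣≡2 {x} {y} x≢y = ≤-antisym at-most at-least
    where
    at-most : ∣ ⁅ x ⁆ ∪ ⁅ y ⁆ ∣ ≤ 2
    at-most = ≤-trans (∣p∪q∣≤∣p∣+∣q∣ ⁅ x ⁆ ⁅ y ⁆)
                      (≤-reflexive (cong₂ _+_ (∣⁅x⁆∣≡1 x) (∣⁅x⁆∣≡1 y)))
    at-least : 2 ≤ ∣ ⁅ x ⁆ ∪ ⁅ y ⁆ ∣
    at-least = ≤-trans (s≤s (≤-reflexive (≡-sym (∣⁅x⁆∣≡1 y))))
                       (∣p∣<∣⁅x⁆∪p∣ λ x∈⁅y⁆ → x≢y (x∈⁅y⁆⇒x≡y y x∈⁅y⁆))

  sameEdge⇒y∈⁅u⁆∪⁅v⁆ : ∀ {x y u v : Fin n} → (x ≡ u × y ≡ v) ⊎ (x ≡ v × y ≡ u) →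
                       y ∈ ⁅ u ⁆ ∪ ⁅ v ⁆
  sameEdge⇒y∈⁅u⁆∪⁅v⁆ {u = u} {v} (inj₁ (_ , refl)) = y∈⁅x⁆∪⁅y⁆ u v
  sameEdge⇒y∈⁅u⁆∪⁅v⁆ {u = u} {v} (inj₂ (_ , refl)) = x∈⁅x⁆∪⁅y⁆ u v

module _ {n : ℕ} (G : Graph n) where

  adj⇒≢ : ∀ {u v} → Adj G u v → u ≢ v
  adj⇒≢ uv refl = irrefl G uv

  reachable⇒edge : ∀ {u v} → Reachable G u v → u ≢ v → ∃₂ (Adj G)
  reachable⇒edge here           u≢u = contradiction refl u≢u
  reachable⇒edge (step uw _) _   = _ , _ , uw

  inClosedNbhd? : ∀ v w → Dec (InClosedNbhd G v w)
  inClosedNbhd? v w = (w ≟ v) ⊎-dec adj? G v w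

  oneNearlyIndependent? : ∀ S → Dec (OneNearlyIndependent G S)
  oneNearlyIndependent? S =
    any? λ u → any? λ v → (u ∈? S) ×-dec (v ∈? S) ×-dec adj? G u v ×-dec
      all? λ x → all? λ y → (x ∈? S) →-dec (y ∈? S) →-dec adj? G x y →-dec
        (((x ≟ u) ×-dec (y ≟ v)) ⊎-dec ((x ≟ v) ×-dec (y ≟ u)))

  alpha1-exists : ∀ {S} → OneNearlyIndependent G S → ∃ (IsAlpha1 G)
  alpha1-exists {S} S-oni
    with greatest-bounded (λ k → anySubset? λ T → oneNearlyIndependent? T ×-dec (∣ T ∣ ℕ.≟ k))
                          n (S , S-oni , refl) (λ { (T , _ , refl) → ∣p∣≤n T })
  ... | k , attained , greatest = k , attained , λ T T-oni → greatest (T , T-oni , refl)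

  edge-oni : ∀ {u v} → Adj G u v → OneNearlyIndependent G (⁅ u ⁆ ∪ ⁅ v ⁆)
  edge-oni {u} {v} uv = u , v , x∈⁅x⁆∪⁅y⁆ u v , y∈⁅x⁆∪⁅y⁆ u v , uv , only-uv
    where
    only-uv : ∀ x y → x ∈ ⁅ u ⁆ ∪ ⁅ v ⁆ → y ∈ ⁅ u ⁆ ∪ ⁅ v ⁆ → Adj G x y →
              (x ≡ u × y ≡ v) ⊎ (x ≡ v × y ≡ u)
    only-uv x y x∈ y∈ xy with x∈⁅y⁆∪⁅z⁆⁻ x∈ | x∈⁅y⁆∪⁅z⁆⁻ y∈
    ... | inj₁ refl | inj₁ refl = contradiction xy (irrefl G)
    ... | inj₁ refl | inj₂ refl = inj₁ (refl , refl)
    ... | inj₂ refl | inj₁ refl = inj₂ (refl , refl)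
    ... | inj₂ refl | inj₂ refl = contradiction xy (irrefl G)

  isolated-∪-oni : ∀ {w S} → (∀ {y} → y ∈ S → ¬ Adj G w y) →
                   OneNearlyIndependent G S → OneNearlyIndependent G (⁅ w ⁆ ∪ S)
  isolated-∪-oni {w} {S} w-isolated (u , v , u∈S , v∈S , uv , only-uv) =
    u , v , x∈p∪q⁺ (inj₂ u∈S) , x∈p∪q⁺ (inj₂ v∈S) , uv , only-uv′
    where
    only-uv′ : ∀ x y → x ∈ ⁅ w ⁆ ∪ S → y ∈ ⁅ w ⁆ ∪ S → Adj G x y →
               (x ≡ u × y ≡ v) ⊎ (x ≡ v × y ≡ u)
    only-uv′ x y x∈ y∈ xy with x∈p∪q⁻ ⁅ w ⁆ S x∈ | x∈p∪q⁻ ⁅ w ⁆ S y∈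
    ... | inj₂ x∈S | inj₂ y∈S = only-uv x y x∈S y∈S xy
    ... | inj₁ x∈⁅w⁆ | inj₁ y∈⁅w⁆
      with refl ← x∈⁅y⁆⇒x≡y w x∈⁅w⁆ | refl ← x∈⁅y⁆⇒x≡y w y∈⁅w⁆ = contradiction xy (irrefl G)
    ... | inj₁ x∈⁅w⁆ | inj₂ y∈S with refl ← x∈⁅y⁆⇒x≡y w x∈⁅w⁆ = contradiction xy (w-isolated y∈S)
    ... | inj₂ x∈S | inj₁ y∈⁅w⁆
      with refl ← x∈⁅y⁆⇒x≡y w y∈⁅w⁆ = contradiction (Graph.sym G xy) (w-isolated x∈S)

  non-good-edge-oni : ∀ {u v w} → Adj G u v →
                      ¬ InClosedNbhd G u w → ¬ InClosedNbhd G v w →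
                      OneNearlyIndependent G (⁅ w ⁆ ∪ ⁅ u ⁆ ∪ ⁅ v ⁆) ×
                      3 ≤ ∣ ⁅ w ⁆ ∪ ⁅ u ⁆ ∪ ⁅ v ⁆ ∣
  non-good-edge-oni {u} {v} {w} uv w∉N[u] w∉N[v] =
    isolated-∪-oni isolated (edge-oni uv) ,
    ≤-trans (s≤s (≤-reflexive (≡-sym (∣⁅x⁆∪⁅y⁆∣≡2 (adj⇒≢ uv))))) (∣p∣<∣⁅x⁆∪p∣ w∉uv)
    where
    isolated : ∀ {y} → y ∈ ⁅ u ⁆ ∪ ⁅ v ⁆ → ¬ Adj G w y
    isolated y∈ wy with x∈⁅y⁆∪⁅z⁆⁻ y∈
    ... | inj₁ refl = w∉N[u] (inj₂ (Graph.sym G wy))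
    ... | inj₂ refl = w∉N[v] (inj₂ (Graph.sym G wy))
    w∉uv : w ∉ ⁅ u ⁆ ∪ ⁅ v ⁆
    w∉uv w∈ with x∈⁅y⁆∪⁅z⁆⁻ w∈
    ... | inj₁ w≡u = w∉N[u] (inj₁ w≡u)
    ... | inj₂ w≡v = w∉N[v] (inj₁ w≡v)

  good-edge⇒oni⊆edge : ∀ {S} → ((u , v , _) : OneNearlyIndependent G S) →
                       GoodEdge G u v → S ⊆ ⁅ u ⁆ ∪ ⁅ v ⁆
  good-edge⇒oni⊆edge (u , v , u∈S , v∈S , _ , only-uv) good {x} x∈S with good x
  ... | inj₁ (inj₁ refl) = x∈⁅x⁆∪⁅y⁆ u v
  ... | inj₂ (inj₁ refl) = y∈⁅x⁆∪⁅y⁆ u v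
  ... | inj₁ (inj₂ ux) = sameEdge⇒y∈⁅u⁆∪⁅v⁆ (only-uv u x u∈S x∈S ux)
  ... | inj₂ (inj₂ vx) = sameEdge⇒y∈⁅u⁆∪⁅v⁆ (only-uv v x v∈S x∈S vx)

  good⇒oni-size≤2 : GoodGraph G → ∀ {S} → OneNearlyIndependent G S → ∣ S ∣ ≤ 2
  good⇒oni-size≤2 good S-oni@(u , v , _ , _ , uv , _) =
    ≤-trans (p⊆q⇒∣p∣≤∣q∣ (good-edge⇒oni⊆edge S-oni (good u v uv)))
            (≤-reflexive (∣⁅x⁆∪⁅y⁆∣≡2 (adj⇒≢ uv)))

  good⇒alpha1≤2 : GoodGraph G → ∀ {k} → IsAlpha1 G k → k ≤ 2
  good⇒alpha1≤2 good ((S , S-oni , refl) , _) = good⇒oni-size≤2 good S-oni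

  alpha1≤2⇒good : ∀ {k} → IsAlpha1 G k → k ≤ 2 → GoodGraph G
  alpha1≤2⇒good (_ , maximal) k≤2 u v uv w
    with inClosedNbhd? u w ⊎-dec inClosedNbhd? v w
  ... | yes w∈N[u]∪N[v] = w∈N[u]∪N[v]
  ... | no w∉N[u]∪N[v]
    with T-oni , 3≤∣T∣ ← non-good-edge-oni uv (w∉N[u]∪N[v] ∘ inj₁) (w∉N[u]∪N[v] ∘ inj₂)
    = contradiction (≤-trans 3≤∣T∣ (≤-trans (maximal _ T-oni) k≤2)) λ { (s≤s (s≤s ())) }

connected⇒edge : ∀ {n} (G : Graph n) → 2 ≤ n → Connected G → ∃₂ (Adj G)
connected⇒edge G (s≤s (s≤s _)) connected =
  reachable⇒edge G (connected Fin.zero (Fin.suc Fin.zero)) λ ()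

theorem3 : ∀ {n : ℕ} (G : Graph n) → 2 ≤ n → Connected G →
    Σ ℕ λ k → IsAlpha1 G k × 2 ≤ k × (k ≡ 2 ⇔ GoodGraph G)
theorem3 G 2≤n connected
  with u , v , uv ← connected⇒edge G 2≤n connected
  with k , α₁@(_ , maximal) ← alpha1-exists G (edge-oni G uv)
  = k , α₁ , 2≤k , mk⇔ (alpha1≤2⇒good G α₁ ∘ ≤-reflexive)
                       (λ good → ≤-antisym (good⇒alpha1≤2 G good α₁) 2≤k)
  where
  2≤k : 2 ≤ k
  2≤k = ≤-trans (≤-reflexive (≡-sym (∣⁅x⁆∪⁅y⁆∣≡2 (adj⇒≢ G uv)))) (maximal _ (edge-oni G uv))
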